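{- Let $G$ be a graph with matching $M$. If $(u,v)$ is a matched edge, then $\mathrm{t}(u)=\mathrm{t}(v)=\mathrm{t}(u,v)$.
   Context: $G=(V,E)$ is a finite undirected graph and $M$ a matching; edges in $M$ are matched, others unmatched; a vertex is unmatched if no matched edge is incident to it. An alternating path is a simple path whose edges alternate between matched and unmatched. $\mathrm{evenlevel}(v)$ ($\mathrm{oddlevel}(v)$) is the length of a minimum even (odd) length alternating path from some unmatched vertex to $v$, or $\infty$ if none exists (an unmatched vertex has evenlevel $0$). The tenacity of a vertex is $\mathrm{t}(v)=\mathrm{evenlevel}(v)+\mathrm{oddlevel}(v)$. The tenacity of an unmatched edge $(u,v)$ is $\mathrm{evenlevel}(u)+\mathrm{evenlevel}(v)+1$ and of a matched edge $(u,v)$ is $\mathrm{oddlevel}(u)+\mathrm{oddlevel}(v)+1$. -}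

module Defs where

open import Data.Nat using (ℕ; zero; suc; _+_; _≤_; _%_)
open import Data.Fin using (Fin; zero; suc; toℕ; fromℕ; inject₁)
open import Data.Product using (Σ; _×_)
open import Data.Empty using (⊥)
open import Relation.Nullary using (¬_)
open import Relation.Binary.PropositionalEquality using (_≡_)
open import Function.Definitions using (Injective)

record Graph (n : ℕ) : Set₁ where
  field
    Adj     : Fin n → Fin n → Set
    Adj-sym : ∀ {u v} → Adj u v → Adj v u
    Adj-irr : ∀ {u} → ¬ Adj u u

record Matching {n : ℕ} (G : Graph n) : Set₁ where
  field
    Matched     : Fin n → Fin n → Set
    Matched-sym : ∀ {u v} → Matched u v → Matched v u
    Matched⊆E   : ∀ {u v} → Matched u v → Graph.Adj G u v
    Matched-uniq : ∀ {u v w} → Matched u v → Matched u w → v ≡ w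

module _ {n : ℕ} (G : Graph n) (M : Matching G) where
  open Graph G
  open Matching M

  Unmatched : Fin n → Set
  Unmatched v = ∀ w → ¬ Matched v w

  record AltPath (v : Fin n) (k : ℕ) : Set where
    field
      p        : Fin (suc k) → Fin n
      start    : Unmatched (p zero)
      end      : p (fromℕ k) ≡ v
      simple   : Injective _≡_ _≡_ p
      edges    : ∀ (i : Fin k) → Adj (p (inject₁ i)) (p (suc i))
      alt      : ∀ (i j : Fin k) → toℕ j ≡ suc (toℕ i) →
                 (Matched (p (inject₁ i)) (p (suc i)) → ¬ Matched (p (inject₁ j)) (p (suc j)))
                 × (¬ Matched (p (inject₁ i)) (p (suc i)) → Matched (p (inject₁ j)) (p (suc j)))

  Even Odd : ℕ → Set
  Even k = k % 2 ≡ 0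
  Odd  k = k % 2 ≡ 1

data ℕ∞ : Set where
  fin : ℕ → ℕ∞
  ∞   : ℕ∞

infixl 6 _⊕_
_⊕_ : ℕ∞ → ℕ∞ → ℕ∞
fin a ⊕ fin b = fin (a + b)
fin _ ⊕ ∞     = ∞
∞     ⊕ _     = ∞

module _ {n : ℕ} (G : Graph n) (M : Matching G) where

  IsMinLevel : (ℕ → Set) → Fin n → ℕ∞ → Set
  IsMinLevel P v (fin k) =
    P k × AltPath G M v k × (∀ k′ → P k′ → AltPath G M v k′ → k ≤ k′)
  IsMinLevel P v ∞ = ∀ k → P k → ¬ AltPath G M v k

  IsEvenLevel IsOddLevel : Fin n → ℕ∞ → Set
  IsEvenLevel = IsMinLevel (Even G M)
  IsOddLevel  = IsMinLevel (Odd G M)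

-- If (u , v) is matched, the last edge of any even alternating path to u is the matched
-- edge (v , u), so cutting it off gives an odd alternating path to v; conversely an odd
-- alternating path to v ends with an unmatched edge and cannot pass through u, so it
-- extends by (v , u).  Hence evenlevel(u) = oddlevel(v) + 1 and symmetrically
-- evenlevel(v) = oddlevel(u) + 1, and both tenacities equal oddlevel(u) + oddlevel(v) + 1.
module Submission where

open import Defs
open import Data.Fin using (Fin; zero; suc; toℕ; fromℕ; inject₁; fromℕ<)
open import Data.Fin.Properties
  using (toℕ-inject₁; toℕ-fromℕ; toℕ-fromℕ<; toℕ<n; toℕ-injective; inject₁-injective; fromℕ≢inject₁)
  renaming (suc-injective to fsuc-injective)
open import Data.Fin.Relation.Unary.Top using (view; ‵fromℕ; ‵inject₁)
open import Data.Nat using (ℕ; zero; suc; _<_; _%_; s≤s)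
open import Data.Nat.Properties using (≤-antisym; <⇒≤; <⇒≢; n<1+n; +-comm; +-assoc)
  renaming (suc-injective to ℕ-suc-injective)
open import Data.Product using (Σ; _×_; _,_; proj₁; proj₂)
open import Data.Empty using (⊥-elim)
open import Data.Vec.Functional using (Vector; tail; init)
open import Relation.Nullary using (¬_)
open import Relation.Binary.PropositionalEquality
  using (_≡_; _≢_; refl; sym; trans; cong; subst; subst₂; module ≡-Reasoning)

⊕-comm : ∀ x y → x ⊕ y ≡ y ⊕ x
⊕-comm (fin a) (fin b) = cong fin (+-comm a b)
⊕-comm (fin _) ∞       = refl
⊕-comm ∞       (fin _) = refl
⊕-comm ∞       ∞       = refl

⊕-assoc : ∀ x y z → (x ⊕ y) ⊕ z ≡ x ⊕ (y ⊕ z)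
⊕-assoc (fin a) (fin b) (fin c) = cong fin (+-assoc a b c)
⊕-assoc (fin _) (fin _) ∞       = refl
⊕-assoc (fin _) ∞       _       = refl
⊕-assoc ∞       _       _       = refl

even-suc⇒odd : ∀ m → suc m % 2 ≡ 0 → m % 2 ≡ 1
even-suc⇒odd (suc zero)    _ = refl
even-suc⇒odd (suc (suc m)) h = even-suc⇒odd m h

odd-suc⇒even : ∀ m → suc m % 2 ≡ 1 → m % 2 ≡ 0
odd-suc⇒even zero          _ = refl
odd-suc⇒even (suc (suc m)) h = odd-suc⇒even m h

odd⇒even-suc : ∀ m → m % 2 ≡ 1 → suc m % 2 ≡ 0
odd⇒even-suc (suc zero)    _ = refl
odd⇒even-suc (suc (suc m)) h = odd⇒even-suc m h

infixl 5 _∷ʳ_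
_∷ʳ_ : ∀ {a} {A : Set a} {k} → Vector A k → A → Vector A (suc k)
_∷ʳ_ {k = zero}  xs y zero    = y
_∷ʳ_ {k = suc k} xs y zero    = xs zero
_∷ʳ_ {k = suc k} xs y (suc i) = (tail xs ∷ʳ y) i

∷ʳ-inject₁ : ∀ {a} {A : Set a} {k} (xs : Vector A k) y (i : Fin k) → (xs ∷ʳ y) (inject₁ i) ≡ xs i
∷ʳ-inject₁ {k = suc k} xs y zero    = refl
∷ʳ-inject₁ {k = suc k} xs y (suc i) = ∷ʳ-inject₁ (tail xs) y i

∷ʳ-fromℕ : ∀ {a} {A : Set a} {k} (xs : Vector A k) y → (xs ∷ʳ y) (fromℕ k) ≡ y
∷ʳ-fromℕ {k = zero}  xs y = refl
∷ʳ-fromℕ {k = suc k} xs y = ∷ʳ-fromℕ (tail xs) y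

module AlternatingPaths {n} (G : Graph n) (M : Matching G) where
  open Graph G
  open Matching M

  MatchedAt : ∀ {k} → Vector (Fin n) (suc k) → Fin k → Set
  MatchedAt p i = Matched (p (inject₁ i)) (p (suc i))

  module _ {x k} (P : AltPath G M x k) where
    open AltPath P

    -- Measured by toℕ i, since the edge preceding suc i is inject₁ i, not i.
    edge-parity : ∀ m (i : Fin k) → toℕ i ≡ m →
                  (m % 2 ≡ 0 → ¬ MatchedAt p i) × (m % 2 ≡ 1 → MatchedAt p i)
    edge-parity zero    zero refl = (λ _ → start _) , λ ()
    edge-parity (suc m) i toℕi≡1+m =
        (λ even → proj₁ step (proj₂ previous (even-suc⇒odd m even)))
      , (λ odd  → proj₂ step (proj₁ previous (odd-suc⇒even m odd)))
      where
      m<k : m < k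
      m<k = <⇒≤ (subst (_< k) toℕi≡1+m (toℕ<n i))
      previous = edge-parity m (fromℕ< m<k) (toℕ-fromℕ< m<k)
      step = alt (fromℕ< m<k) i (trans toℕi≡1+m (cong suc (sym (toℕ-fromℕ< m<k))))

  module _ {x k} (P : AltPath G M x (suc k)) where
    open AltPath P

    even-path-ends-matched : suc k % 2 ≡ 0 → MatchedAt p (fromℕ k)
    even-path-ends-matched even =
      proj₂ (edge-parity P k (fromℕ k) (toℕ-fromℕ k)) (even-suc⇒odd k even)

    odd-path-ends-unmatched : suc k % 2 ≡ 1 → ¬ MatchedAt p (fromℕ k)
    odd-path-ends-unmatched odd =
      proj₁ (edge-parity P k (fromℕ k) (toℕ-fromℕ k)) (odd-suc⇒even k odd)

    prefix : AltPath G M (p (inject₁ (fromℕ k))) k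
    prefix = record
      { p      = init p
      ; start  = start
      ; end    = refl
      ; simple = λ eq → inject₁-injective (simple eq)
      ; edges  = λ i → edges (inject₁ i)
      ; alt    = λ i j j≡1+i → alt (inject₁ i) (inject₁ j)
                   (trans (toℕ-inject₁ j) (trans j≡1+i (cong suc (sym (toℕ-inject₁ i)))))
      }

    extend : ∀ {y} → ¬ MatchedAt p (fromℕ k) → (∀ i → p i ≢ y) → Matched x y →
             AltPath G M y (suc (suc k))
    extend {y} last-unmatched y∉P x–y = record
      { p      = q
      ; start  = start
      ; end    = ∷ʳ-fromℕ p y
      ; simple = simple′
      ; edges  = edges′
      ; alt    = alt′
      }
      where
      q : Vector (Fin n) (suc (suc (suc k)))
      q = p ∷ʳ y

      q-inject₁ : ∀ i → q (inject₁ i) ≡ p i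
      q-inject₁ = ∷ʳ-inject₁ p y

      q-penultimate : q (inject₁ (fromℕ (suc k))) ≡ x
      q-penultimate = trans (q-inject₁ (fromℕ (suc k))) end

      toP : ∀ i → MatchedAt q (inject₁ i) → MatchedAt p i
      toP i = subst₂ Matched (q-inject₁ (inject₁ i)) (q-inject₁ (suc i))

      fromP : ∀ i → MatchedAt p i → MatchedAt q (inject₁ i)
      fromP i = subst₂ Matched (sym (q-inject₁ (inject₁ i))) (sym (q-inject₁ (suc i)))

      last-matched : MatchedAt q (fromℕ (suc k))
      last-matched = subst₂ Matched (sym q-penultimate) (sym (∷ʳ-fromℕ p y)) x–y

      simple′ : ∀ {i j} → q i ≡ q j → i ≡ j
      simple′ {i} {j} qi≡qj with view i | view j
      ... | ‵fromℕ     | ‵fromℕ     = refl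
      ... | ‵fromℕ     | ‵inject₁ j =
        ⊥-elim (y∉P j (trans (sym (q-inject₁ j)) (trans (sym qi≡qj) (∷ʳ-fromℕ p y))))
      ... | ‵inject₁ i | ‵fromℕ     =
        ⊥-elim (y∉P i (trans (sym (q-inject₁ i)) (trans qi≡qj (∷ʳ-fromℕ p y))))
      ... | ‵inject₁ i | ‵inject₁ j =
        cong inject₁ (simple (trans (sym (q-inject₁ i)) (trans qi≡qj (q-inject₁ j))))

      edges′ : ∀ i → Adj (q (inject₁ i)) (q (suc i))
      edges′ i with view i
      ... | ‵fromℕ     = subst₂ Adj (sym q-penultimate) (sym (∷ʳ-fromℕ p y)) (Matched⊆E x–y)
      ... | ‵inject₁ i = subst₂ Adj (sym (q-inject₁ (inject₁ i))) (sym (q-inject₁ (suc i))) (edges i)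

      alt′ : ∀ i j → toℕ j ≡ suc (toℕ i) →
             (MatchedAt q i → ¬ MatchedAt q j) × (¬ MatchedAt q i → MatchedAt q j)
      alt′ i j j≡1+i with view i | view j
      ... | ‵fromℕ     | ‵fromℕ     = ⊥-elim (<⇒≢ (n<1+n _) j≡1+i)
      ... | ‵fromℕ     | ‵inject₁ j =
        ⊥-elim (<⇒≢ (toℕ<n (inject₁ j)) (trans j≡1+i (cong suc (toℕ-fromℕ (suc k)))))
      ... | ‵inject₁ i | ‵fromℕ     =
          (λ qi _ → last-unmatched (subst (MatchedAt p) (sym last≡i) (toP i qi)))
        , (λ _ → last-matched)
        where
        last≡i : fromℕ k ≡ i
        last≡i = toℕ-injective (trans (ℕ-suc-injective j≡1+i) (toℕ-inject₁ i))
      ... | ‵inject₁ i | ‵inject₁ j =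
          (λ qi qj → proj₁ step (toP i qi) (toP j qj))
        , (λ ¬qi → fromP j (proj₂ step (λ pi → ¬qi (fromP i pi))))
        where
        step = alt i j (trans (sym (toℕ-inject₁ j)) (trans j≡1+i (cong suc (toℕ-inject₁ i))))

  level-shift : ∀ {P Q : ℕ → Set} {x y l l′} →
    (∀ k → P k → AltPath G M x k → Σ ℕ λ k′ → k ≡ suc k′ × Q k′ × AltPath G M y k′) →
    (∀ k → Q k → AltPath G M y k → P (suc k) × AltPath G M x (suc k)) →
    IsMinLevel G M P x l → IsMinLevel G M Q y l′ → l ≡ l′ ⊕ fin 1
  level-shift {l = fin a} {fin b} shorten lengthen (Pa , A , minA) (Qb , B , minB)
    with shorten a Pa A
  ... | k′ , refl , Qk′ , A′ =
    cong fin (trans (≤-antisym (minA (suc b) P[1+b] B′) (s≤s (minB k′ Qk′ A′))) (+-comm 1 b))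
    where
    P[1+b] = proj₁ (lengthen b Qb B)
    B′     = proj₂ (lengthen b Qb B)
  level-shift {l = fin a} {∞} shorten _ (Pa , A , _) no-path-to-y with shorten a Pa A
  ... | k′ , _ , Qk′ , A′ = ⊥-elim (no-path-to-y k′ Qk′ A′)
  level-shift {l = ∞} {fin b} _ lengthen no-path-to-x (Qb , B , _) =
    ⊥-elim (no-path-to-x (suc b) (proj₁ (lengthen b Qb B)) (proj₂ (lengthen b Qb B)))
  level-shift {l = ∞} {∞} _ _ _ _ = refl

  module _ {u v} (u–v : Matched u v) where

    u≢v : u ≢ v
    u≢v u≡v = Adj-irr (subst (Adj u) (sym u≡v) (Matched⊆E u–v))

    edge-into-partner-unmatched : ∀ {k} (P : AltPath G M v (suc k)) (i : Fin (suc k)) →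
                                  AltPath.p P (suc i) ≡ u → ¬ MatchedAt (AltPath.p P) i
    edge-into-partner-unmatched P i pi≡u matched =
      fromℕ≢inject₁ (simple (trans end (Matched-uniq u–v u–pi)))
      where
      open AltPath P
      u–pi = subst (λ w → Matched w (p (inject₁ i))) pi≡u (Matched-sym matched)

    -- u cannot start the path (it is matched), cannot be entered by a matched edge
    -- (that edge would be (v , u), revisiting the endpoint v), and cannot be left by
    -- a matched edge (that edge would be the last one, which is unmatched).
    partner-∉-odd-path : ∀ {k} (P : AltPath G M v k) → k % 2 ≡ 1 → ∀ i → AltPath.p P i ≢ u
    partner-∉-odd-path {suc k} P odd zero p0≡u =
      AltPath.start P v (subst (λ w → Matched w v) (sym p0≡u) u–v)
    partner-∉-odd-path {suc k} P odd (suc i) pi≡u with view i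
    ... | ‵fromℕ     = u≢v (trans (sym pi≡u) (AltPath.end P))
    ... | ‵inject₁ i =
      odd-path-ends-unmatched P odd (subst (MatchedAt p) (sym last≡leaving) leaving-matched)
      where
      open AltPath P
      leaving-matched : MatchedAt p (suc i)
      leaving-matched = proj₂ (alt (inject₁ i) (suc i) (cong suc (sym (toℕ-inject₁ i))))
                              (edge-into-partner-unmatched P (inject₁ i) pi≡u)
      last≡leaving : fromℕ k ≡ suc i
      last≡leaving = fsuc-injective (simple (trans end
        (Matched-uniq u–v (subst (λ w → Matched w _) pi≡u leaving-matched))))

    even-path-to-u⇒odd-path-to-v : ∀ k → k % 2 ≡ 0 → AltPath G M u k →
                                    Σ ℕ λ k′ → k ≡ suc k′ × k′ % 2 ≡ 1 × AltPath G M v k′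
    even-path-to-u⇒odd-path-to-v zero _ P =
      ⊥-elim (AltPath.start P v (subst (λ w → Matched w v) (sym (AltPath.end P)) u–v))
    even-path-to-u⇒odd-path-to-v (suc k) even P =
      k , refl , even-suc⇒odd k even , subst (λ w → AltPath G M w k) (sym v≡penultimate) (prefix P)
      where
      open AltPath P
      v≡penultimate : v ≡ p (inject₁ (fromℕ k))
      v≡penultimate = Matched-uniq u–v
        (Matched-sym (subst (Matched _) end (even-path-ends-matched P even)))

    odd-path-to-v⇒even-path-to-u : ∀ k → k % 2 ≡ 1 → AltPath G M v k →
                                    suc k % 2 ≡ 0 × AltPath G M u (suc k)
    odd-path-to-v⇒even-path-to-u (suc k) odd P =
        odd⇒even-suc (suc k) odd
      , extend P (odd-path-ends-unmatched P odd) (partner-∉-odd-path P odd) (Matched-sym u–v)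

    evenlevel≡oddlevel-partner+1 : ∀ {eu ov} → IsEvenLevel G M u eu → IsOddLevel G M v ov →
                                   eu ≡ ov ⊕ fin 1
    evenlevel≡oddlevel-partner+1 =
      level-shift even-path-to-u⇒odd-path-to-v odd-path-to-v⇒even-path-to-u

open AlternatingPaths using (evenlevel≡oddlevel-partner+1)

lemma5p1 : ∀ {n} (G : Graph n) (M : Matching G) (u v : Fin n) →
    Matching.Matched M u v →
    ∀ (eu ou ev ov : ℕ∞) →
    IsEvenLevel G M u eu → IsOddLevel G M u ou →
    IsEvenLevel G M v ev → IsOddLevel G M v ov →
    (eu ⊕ ou ≡ ou ⊕ ov ⊕ fin 1) × (ev ⊕ ov ≡ ou ⊕ ov ⊕ fin 1)
lemma5p1 G M u v u–v eu ou ev ov heu hou hev hov = tenacity-u , tenacity-v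
  where
  open ≡-Reasoning
  tenacity-u : eu ⊕ ou ≡ ou ⊕ ov ⊕ fin 1
  tenacity-u = begin
    eu ⊕ ou             ≡⟨ cong (_⊕ ou) (evenlevel≡oddlevel-partner+1 G M u–v heu hov) ⟩
    ov ⊕ fin 1 ⊕ ou     ≡⟨ ⊕-comm (ov ⊕ fin 1) ou ⟩
    ou ⊕ (ov ⊕ fin 1)   ≡⟨ ⊕-assoc ou ov (fin 1) ⟨
    ou ⊕ ov ⊕ fin 1     ∎
  tenacity-v : ev ⊕ ov ≡ ou ⊕ ov ⊕ fin 1
  tenacity-v = begin
    ev ⊕ ov             ≡⟨ cong (_⊕ ov) (evenlevel≡oddlevel-partner+1 G M (Matching.Matched-sym M u–v) hev hou) ⟩
    ou ⊕ fin 1 ⊕ ov     ≡⟨ ⊕-assoc ou (fin 1) ov ⟩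
    ou ⊕ (fin 1 ⊕ ov)   ≡⟨ cong (ou ⊕_) (⊕-comm (fin 1) ov) ⟩
    ou ⊕ (ov ⊕ fin 1)   ≡⟨ ⊕-assoc ou ov (fin 1) ⟨
    ou ⊕ ov ⊕ fin 1     ∎
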